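{- Let $T = \langle S, Act, \to\rangle$ be a labelled transition system and let $s, s' \in S$ be arbitrary states. Then $s$ and $s'$ are completed trace equivalent in $T$ if and only if $s$ and $s'$ are trace equivalent in the Kripke structure $\mathsf{ks}(T)$.
   Context: A Kripke structure is $K=\langle S, AP, \to, L\rangle$ with $S$ a set of states, $AP$ a set of atomic propositions, $\to\,\subseteq S\times S$ a total transition relation (for every $s\in S$ there is $t\in S$ with $s\to t$), and $L: S\to 2^{AP}$ a state labelling. A labelled transition system (LTS) is $T=\langle S, Act, \to\rangle$ with $S$ a set of states, $Act$ a set of actions, a special silent action $\tau\notin Act$, and a transition relation $\to\,\subseteq S\times(Act\cup\{\tau\})\times S$ that is total (for every $s\in S$ there are $a\in Act$, $t\in S$ with $s\xrightarrow{a}t$). The embedding $\mathsf{ks}$: for an LTS $T=\langle S,Act,\to\rangle$, $\mathsf{ks}(T)=\langle S', AP, \to', L\rangle$ where $S' = S\cup\{(s,a,t)\in\,\to \mid a\neq\tau\}$, $AP = Act\cup\{\bot\}$ with $\bot\notin Act$ fresh, $\to'$ is the least relation such that for every transition $(s,a,t)$ with $a\neq\tau$ we have $s\to'(s,a,t)$ and $(s,a,t)\to' t$, and $s\to' t$ whenever $s\xrightarrow{\tau}t$; and $L(s)=\{\bot\}$ for $s\in S$, $L((s,a,t))=\{a\}$. Trace equivalence in a Kripke structure: a path from $s$ is an infinite sequence $s_0 s_1\ldots$ of states with $s_0=s$ and $s_i\to s_{i+1}$ for all $i$; its trace is the infinite sequence $L(s_0)L(s_1)\ldots$; states $s,s'$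 are trace equivalent iff the set of traces of paths from $s$ equals the set of traces of paths from $s'$. Completed trace equivalence in an LTS: a run from $s$ is an infinite alternating sequence $s_0 a_0 s_1 a_1\ldots$ with $s_0=s$ and $s_i\xrightarrow{a_i}s_{i+1}$ for all $i$ (the $a_i$ range over $Act\cup\{\tau\}$); its trace is the infinite sequence $a_0a_1\ldots$; states $s,s'$ are completed trace equivalent iff the set of traces of runs from $s$ equals the set of traces of runs from $s'$. -}

module Defs where

open import Data.Nat using (ℕ; zero; suc)
open import Data.Product using (Σ; ∃; ∃₂; _×_; _,_)
open import Data.Maybe using (Maybe; just; nothing)
open import Relation.Binary.PropositionalEquality using (_≡_)
open import Relation.Unary using (Pred; _≐_)
open import Function.Bundles using (_⇔_)

-- Kripke structures: S, AP, total transition relation, labelling L : S → 2^AP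
-- (subsets of AP represented as predicates AP → Set; equality of label
-- sets is extensional equality _≐_).

record Kripke : Set₁ where
  field
    State : Set
    AP    : Set
    _⇒_   : State → State → Set
    total : ∀ s → ∃ λ t → s ⇒ t
    L     : State → Pred AP _

module _ (K : Kripke) where
  open Kripke K

  record KPath (s : State) : Set where
    field
      at    : ℕ → State
      start : at zero ≡ s
      step  : ∀ i → at i ⇒ at (suc i)

  KTraceOf : State → (ℕ → Pred AP _) → Set₁
  KTraceOf s σ = Σ (KPath s) λ π → ∀ i → σ i ≐ L (KPath.at π i)

  TraceEquiv : State → State → Set₂
  TraceEquiv s s' = ∀ (σ : ℕ → Pred AP _) → KTraceOf s σ ⇔ KTraceOf s' σ

data Lab (A : Set) : Set where
  τ   : Lab A
  act : A → Lab A

record LTS : Set₁ where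
  field
    State : Set
    Act   : Set
    _—[_]→_ : State → Lab Act → State → Set
    total : ∀ s → ∃₂ λ a t → s —[ act a ]→ t

module _ (T : LTS) where
  open LTS T

  record Run (s : State) : Set where
    field
      at    : ℕ → State
      lab   : ℕ → Lab Act
      start : at zero ≡ s
      step  : ∀ i → at i —[ lab i ]→ at (suc i)

  CTraceOf : State → (ℕ → Lab Act) → Set
  CTraceOf s σ = Σ (Run s) λ r → ∀ i → Run.lab r i ≡ σ i

  CompletedTraceEquiv : State → State → Set
  CompletedTraceEquiv s s' = ∀ (σ : ℕ → Lab Act) → CTraceOf s σ ⇔ CTraceOf s' σ

  data KState : Set where
    st  : State → KState
    mid : (s : State) (a : Act) (t : State) → s —[ act a ]→ t → KState

  data _⇒ks_ : KState → KState → Set where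
    enter  : ∀ {s a t} (p : s —[ act a ]→ t) → st s ⇒ks mid s a t p
    leave  : ∀ {s a t} (p : s —[ act a ]→ t) → mid s a t p ⇒ks st t
    silent : ∀ {s t} → s —[ τ ]→ t → st s ⇒ks st t

  ks-total : ∀ x → ∃ λ y → x ⇒ks y
  ks-total (st s) with total s
  ... | a , t , p = mid s a t p , enter p
  ks-total (mid s a t p) = st t , leave p

  -- AP = Act ∪ {⊥}, with ⊥ represented by nothing
  ksL : KState → Pred (Maybe Act) _
  ksL (st s)        q = q ≡ nothing
  ksL (mid s a t p) q = q ≡ just a

  ks : Kripke
  ks = record
    { State = KState
    ; AP    = Maybe Act
    ; _⇒_   = _⇒ks_
    ; total = ks-total
    ; L     = ksL
    }

module Submission where

-- A sequence of LTS labels ρ is turned into the sequence of ks-observations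
-- `expand ρ`: the initial state shows ⊥ (here `nothing`), every τ-step adds
-- one ⊥, and every visible step a adds the two observations a ⊥ (first the
-- transition state (s,a,t), then the target t).
-- The theorem follows: equal completed trace sets give equal Kripke trace
-- sets directly, and conversely by injectivity of `expand`.

open import Defs
open import Level using (0ℓ; Lift; lift; lower)
import Level
open import Function using (_∘_)
open import Function.Bundles using (_⇔_; mk⇔; Equivalence)
open import Data.Nat using (ℕ; zero; suc)
open import Data.Maybe using (Maybe; just; nothing)
open import Data.Product using (∃; _×_; _,_; proj₁; proj₂)
open import Relation.Unary using (Pred; _≐_)
open import Relation.Unary.Properties using (≐-sym; ≐-trans)
open import Relation.Binary.PropositionalEquality
  using (_≡_; _≗_; refl; sym; trans; cong; module ≡-Reasoning)

module _ (T : LTS) where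
  open LTS T

  Path : State → Set
  Path x = KPath (ks T) (st x)

  observe : KState T → Maybe Act
  observe (st _)        = nothing
  observe (mid _ a _ _) = just a

  ksL≐observe : ∀ x → ksL T x ≐ (_≡ observe x)
  ksL≐observe (st _)        = (λ e → e) , (λ e → e)
  ksL≐observe (mid _ _ _ _) = (λ e → e) , (λ e → e)

  mutual
    expand : (ℕ → Lab Act) → ℕ → Maybe Act
    expand ρ zero    = nothing
    expand ρ (suc n) = expandAfter (ρ zero) (ρ ∘ suc) n

    expandAfter : Lab Act → (ℕ → Lab Act) → ℕ → Maybe Act
    expandAfter τ       ρ n       = expand ρ n
    expandAfter (act a) ρ zero    = just a
    expandAfter (act a) ρ (suc n) = expand ρ n

  mutual
    expand-cong : ∀ {ρ ρ'} → ρ ≗ ρ' → expand ρ ≗ expand ρ'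
    expand-cong h zero    = refl
    expand-cong h (suc n) = expandAfter-cong (h zero) (h ∘ suc) n

    expandAfter-cong : ∀ {ℓ ℓ' ρ ρ'} → ℓ ≡ ℓ' → ρ ≗ ρ' →
                       expandAfter ℓ ρ ≗ expandAfter ℓ' ρ'
    expandAfter-cong {τ}     refl h n       = expand-cong h n
    expandAfter-cong {act a} refl h zero    = refl
    expandAfter-cong {act a} refl h (suc n) = expand-cong h n

  -- The first label is recovered from the first observation after the start.
  headLabel : Maybe Act → Lab Act
  headLabel nothing  = τ
  headLabel (just a) = act a

  expandAfter-head : ∀ ℓ ρ → headLabel (expandAfter ℓ ρ zero) ≡ ℓ
  expandAfter-head τ       ρ = refl
  expandAfter-head (act a) ρ = refl

  -- A step labelled ℓ occupies `skip ℓ` observations beyond the next one: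
  -- none for τ, one extra (the transition state) for a visible action.
  skip : Lab Act → ℕ → ℕ
  skip τ       n = n
  skip (act _) n = suc n

  expandAfter-skip : ∀ ℓ ρ n → expandAfter ℓ ρ (skip ℓ n) ≡ expand ρ n
  expandAfter-skip τ       ρ n = refl
  expandAfter-skip (act a) ρ n = refl

  expand-head : ∀ {ρ ρ'} → expand ρ ≗ expand ρ' → ρ zero ≡ ρ' zero
  expand-head {ρ} {ρ'} h = begin
    ρ zero                      ≡⟨ sym (expandAfter-head (ρ zero) (ρ ∘ suc)) ⟩
    headLabel (expand ρ 1)      ≡⟨ cong headLabel (h 1) ⟩
    headLabel (expand ρ' 1)     ≡⟨ expandAfter-head (ρ' zero) (ρ' ∘ suc) ⟩
    ρ' zero                     ∎
    where open ≡-Reasoning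

  expand-tail : ∀ {ρ ρ'} → expand ρ ≗ expand ρ' → expand (ρ ∘ suc) ≗ expand (ρ' ∘ suc)
  expand-tail {ρ} {ρ'} h n = begin
    expand (ρ ∘ suc) n
      ≡⟨ sym (expandAfter-skip (ρ zero) (ρ ∘ suc) n) ⟩
    expand ρ (suc (skip (ρ zero) n))
      ≡⟨ h _ ⟩
    expand ρ' (suc (skip (ρ zero) n))
      ≡⟨ cong (λ ℓ → expand ρ' (suc (skip ℓ n))) (expand-head h) ⟩
    expand ρ' (suc (skip (ρ' zero) n))
      ≡⟨ expandAfter-skip (ρ' zero) (ρ' ∘ suc) n ⟩
    expand (ρ' ∘ suc) n
      ∎
    where open ≡-Reasoning

  expand-injective : ∀ {ρ ρ'} → expand ρ ≗ expand ρ' → ρ ≗ ρ'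
  expand-injective h zero    = expand-head h
  expand-injective h (suc k) = expand-injective (expand-tail h) k

  runTail : ∀ {x} (r : Run T x) → Run T (Run.at r 1)
  runTail r = record
    { at    = Run.at r ∘ suc
    ; lab   = Run.lab r ∘ suc
    ; start = refl
    ; step  = Run.step r ∘ suc
    }

  mutual
    pathAt : ∀ {x} → Run T x → ℕ → KState T
    pathAt r zero    = st (Run.at r zero)
    pathAt r (suc n) = pathAfter (runTail r) (Run.step r zero) n

    pathAfter : ∀ {x ℓ y} (r : Run T y) → x —[ ℓ ]→ Run.at r zero → ℕ → KState T
    pathAfter {ℓ = τ}     r p n       = pathAt r n
    pathAfter {ℓ = act a} r p zero    = mid _ a _ p
    pathAfter {ℓ = act a} r p (suc n) = pathAt r n

  mutual
    pathStep : ∀ {x} (r : Run T x) n → _⇒ks_ T (pathAt r n) (pathAt r (suc n))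
    pathStep r zero    = enterStep (runTail r) (Run.step r zero)
    pathStep r (suc n) = afterStep (runTail r) (Run.step r zero) n

    enterStep : ∀ {x ℓ y} (r : Run T y) (p : x —[ ℓ ]→ Run.at r zero) →
                _⇒ks_ T (st x) (pathAfter r p zero)
    enterStep {ℓ = τ}     r p = silent p
    enterStep {ℓ = act a} r p = enter p

    afterStep : ∀ {x ℓ y} (r : Run T y) (p : x —[ ℓ ]→ Run.at r zero) n →
                _⇒ks_ T (pathAfter r p n) (pathAfter r p (suc n))
    afterStep {ℓ = τ}     r p n       = pathStep r n
    afterStep {ℓ = act a} r p zero    = leave p
    afterStep {ℓ = act a} r p (suc n) = pathStep r n

  runToPath : ∀ {x} → Run T x → Path x
  runToPath r = record { at = pathAt r ; start = cong st (Run.start r) ; step = pathStep r }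

  mutual
    pathLabel : ∀ {x} (r : Run T x) → observe ∘ pathAt r ≗ expand (Run.lab r)
    pathLabel r zero    = refl
    pathLabel r (suc n) = afterLabel (runTail r) (Run.step r zero) n

    afterLabel : ∀ {x ℓ y} (r : Run T y) (p : x —[ ℓ ]→ Run.at r zero) →
                 observe ∘ pathAfter r p ≗ expandAfter ℓ (Run.lab r)
    afterLabel {ℓ = τ}     r p n       = pathLabel r n
    afterLabel {ℓ = act a} r p zero    = refl
    afterLabel {ℓ = act a} r p (suc n) = pathLabel r n

  suffix : ∀ {u y} (π : KPath (ks T) u) k → KPath.at π k ≡ st y → Path y
  suffix π zero    e = record { at = KPath.at π ; start = e ; step = KPath.step π }
  suffix π (suc k) e = suffix dropFirst k e
    where
    dropFirst : KPath (ks T) (KPath.at π 1)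
    dropFirst = record { at = KPath.at π ∘ suc ; start = refl ; step = KPath.step π ∘ suc }

  data FirstMove {x} (π : Path x) : Set where
    silentFirst  : ∀ {y} (q : x —[ τ ]→ y) → KPath.at π 1 ≡ st y → FirstMove π
    visibleFirst : ∀ {a y} (q : x —[ act a ]→ y) →
                   KPath.at π 1 ≡ mid x a y q → KPath.at π 2 ≡ st y → FirstMove π

  firstMove : ∀ {x} (π : Path x) → FirstMove π
  firstMove {x} π = classify (KPath.start π) (KPath.step π 0) (KPath.step π 1) refl refl
    where
    classify : ∀ {u v w} → u ≡ st x → _⇒ks_ T u v → _⇒ks_ T v w →
               KPath.at π 1 ≡ v → KPath.at π 2 ≡ w → FirstMove π
    classify refl (silent q) _          e₁ e₂ = silentFirst q e₁
    classify refl (enter q)  (leave .q) e₁ e₂ = visibleFirst q e₁ e₂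

  moveLabel : ∀ {x} {π : Path x} → FirstMove π → Lab Act
  moveLabel (silentFirst q e)          = τ
  moveLabel (visibleFirst {a} q e₁ e₂) = act a

  moveTarget : ∀ {x} {π : Path x} → FirstMove π → State
  moveTarget (silentFirst {y} q e)          = y
  moveTarget (visibleFirst {y = y} q e₁ e₂) = y

  moveStep : ∀ {x} {π : Path x} (m : FirstMove π) → x —[ moveLabel m ]→ moveTarget m
  moveStep (silentFirst q e)      = q
  moveStep (visibleFirst q e₁ e₂) = q

  remainder : ∀ {x} {π : Path x} (m : FirstMove π) → Path (moveTarget m)
  remainder {π = π} (silentFirst q e)      = suffix π 1 e
  remainder {π = π} (visibleFirst q e₁ e₂) = suffix π 2 e₂

  runAt : ∀ {x} → Path x → ℕ → State
  runAt {x} π zero = x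
  runAt π (suc n)  = runAt (remainder (firstMove π)) n

  runLab : ∀ {x} → Path x → ℕ → Lab Act
  runLab π zero    = moveLabel (firstMove π)
  runLab π (suc n) = runLab (remainder (firstMove π)) n

  runStep : ∀ {x} (π : Path x) n → runAt π n —[ runLab π n ]→ runAt π (suc n)
  runStep π zero    = moveStep (firstMove π)
  runStep π (suc n) = runStep (remainder (firstMove π)) n

  pathToRun : ∀ {x} → Path x → Run T x
  pathToRun π = record { at = runAt π ; lab = runLab π ; start = refl ; step = runStep π }

  mutual
    runLabel : ∀ {x} (π : Path x) → expand (runLab π) ≗ observe ∘ KPath.at π
    runLabel π zero    = cong observe (sym (KPath.start π))
    runLabel π (suc n) = moveLabelAfter π (firstMove π) n

    moveLabelAfter : ∀ {x} (π : Path x) (m : FirstMove π) →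
                     expandAfter (moveLabel m) (runLab (remainder m)) ≗ observe ∘ KPath.at π ∘ suc
    moveLabelAfter π (silentFirst q e)      n       = runLabel (suffix π 1 e) n
    moveLabelAfter π (visibleFirst q e₁ e₂) zero    = cong observe (sym e₁)
    moveLabelAfter π (visibleFirst q e₁ e₂) (suc n) = runLabel (suffix π 2 e₂) n

  _Describes_ : ∀ {ℓ} → (ℕ → Pred (Maybe Act) ℓ) → (ℕ → Maybe Act) → Set ℓ
  σ Describes w = ∀ i → σ i ≐ (_≡ w i)

  ⟦_⟧ : ∀ {ℓ} → (ℕ → Maybe Act) → ℕ → Pred (Maybe Act) ℓ
  ⟦ w ⟧ i q = Lift _ (q ≡ w i)

  ⟦⟧-describes : ∀ {ℓ} w → ⟦_⟧ {ℓ} w Describes w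
  ⟦⟧-describes w i = lower , lift

  describes-resp : ∀ {ℓ} {σ : ℕ → Pred (Maybe Act) ℓ} {w w'} →
                   σ Describes w → w ≗ w' → σ Describes w'
  describes-resp d e i = (λ p → trans (proj₁ (d i) p) (e i))
                       , (λ p → proj₂ (d i) (trans p (sym (e i))))

  describes-unique : ∀ {ℓ} {σ : ℕ → Pred (Maybe Act) ℓ} {w w'} →
                     σ Describes w → σ Describes w' → w ≗ w'
  describes-unique d d' i = proj₁ (d' i) (proj₂ (d i) refl)

  ctrace-resp : ∀ {s ρ ρ'} → ρ ≗ ρ' → CTraceOf T s ρ → CTraceOf T s ρ'
  ctrace-resp e (r , h) = r , λ i → trans (h i) (e i)

  -- (Kripke traces are predicate sequences at level 1, as fixed by `TraceEquiv`.)
  -- Every completed trace ρ of s yields the Kripke trace `expand ρ` of st s ...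
  ktrace-from-ctrace : ∀ {s ρ} {σ : ℕ → Pred (Maybe Act) (Level.suc 0ℓ)} →
                       CTraceOf T s ρ → σ Describes expand ρ → KTraceOf (ks T) (st s) σ
  ktrace-from-ctrace {ρ = ρ} (r , h) d = runToPath r , λ i →
    ≐-trans (describes-resp d observations i) (≐-sym (ksL≐observe (pathAt r i)))
    where
    observations : expand ρ ≗ observe ∘ pathAt r
    observations i = trans (sym (expand-cong h i)) (sym (pathLabel r i))

  ctrace-from-ktrace : ∀ {s} {σ : ℕ → Pred (Maybe Act) (Level.suc 0ℓ)} → KTraceOf (ks T) (st s) σ →
                       ∃ λ ρ → CTraceOf T s ρ × σ Describes expand ρ
  ctrace-from-ktrace (π , h) =
    runLab π , (pathToRun π , λ i → refl) ,
    describes-resp (λ i → ≐-trans (h i) (ksL≐observe (KPath.at π i))) (sym ∘ runLabel π)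

  ktraces-⊆ : ∀ {s s'} → (∀ ρ → CTraceOf T s ρ → CTraceOf T s' ρ) →
              ∀ σ → KTraceOf (ks T) (st s) σ → KTraceOf (ks T) (st s') σ
  ktraces-⊆ incl σ kt =
    let (ρ , ct , d) = ctrace-from-ktrace kt in ktrace-from-ctrace (incl ρ ct) d

  -- Inclusion of Kripke trace sets gives inclusion of completed trace sets:
  -- transfer the canonical description of `expand ρ`, then invert `expand`.
  ctraces-⊆ : ∀ {s s'} → (∀ σ → KTraceOf (ks T) (st s) σ → KTraceOf (ks T) (st s') σ) →
              ∀ ρ → CTraceOf T s ρ → CTraceOf T s' ρ
  ctraces-⊆ incl ρ ct =
    let kt = ktrace-from-ctrace ct (⟦⟧-describes (expand ρ))
        (ρ' , ct' , d') = ctrace-from-ktrace (incl ⟦ expand ρ ⟧ kt)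
    in ctrace-resp (expand-injective (describes-unique d' (⟦⟧-describes (expand ρ)))) ct'

theorem3p20 : (T : LTS) (s s' : LTS.State T) →
    CompletedTraceEquiv T s s' ⇔ TraceEquiv (ks T) (st s) (st s')
theorem3p20 T s s' = mk⇔
  (λ ce σ → mk⇔ (ktraces-⊆ T (to ∘ ce) σ) (ktraces-⊆ T (from ∘ ce) σ))
  (λ te ρ → mk⇔ (ctraces-⊆ T (to ∘ te) ρ) (ctraces-⊆ T (from ∘ te) ρ))
  where open Equivalence
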